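{- Let $n\ge 2$ and let $R$ be the $n\times n$ matrix with $(i,j)$ entry $\binom{i-1}{n-j}$, $1\le i,j\le n$. For an integer $e\ge1$ let $a^{(e)}_{i,j}$ denote the $(i,j)$ entry of $R^e$. Then for every $e\ge 1$ and all $2\le i\le n$, $2\le j\le n$, \[ F_{e-1}\,a^{(e)}_{i,j}=F_e\,a^{(e)}_{i-1,j}+F_{e+1}\,a^{(e)}_{i-1,j-1}-F_e\,a^{(e)}_{i,j-1}, \] where $(F_m)$ is the Fibonacci sequence.
   Context: Convention: $\binom{m}{k}=0$ if $k<0$ or $k>m$. The Fibonacci sequence is $F_0=0$, $F_1=1$, $F_{m+1}=F_m+F_{m-1}$. -}

module Defs where

open import Data.Nat using (ℕ; zero; suc; _+_; _*_; _∸_)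
open import Data.Nat.ListAction using (sum)
open import Data.Nat.Combinatorics using (_C_)
open import Data.Fin using (Fin; toℕ)
open import Data.List using (map; allFin)

fib : ℕ → ℕ
fib zero = 0
fib (suc zero) = 1
fib (suc (suc m)) = fib (suc m) + fib m

Mat : ℕ → Set
Mat n = Fin n → Fin n → ℕ

I : ∀ {n} → Mat n
I {suc n} Fin.zero Fin.zero = 1
I {suc n} Fin.zero (Fin.suc j) = 0
I {suc n} (Fin.suc i) Fin.zero = 0
I {suc n} (Fin.suc i) (Fin.suc j) = I {n} i j

_⊗_ : ∀ {n} → Mat n → Mat n → Mat n
(A ⊗ B) i k = sum (map (λ j → A i j * B j k) (allFin _))

_^ᴹ_ : ∀ {n} → Mat n → ℕ → Mat n
A ^ᴹ zero = I
A ^ᴹ suc e = (A ^ᴹ e) ⊗ A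

-- R with 1-based (i,j) entry C(i-1, n-j); with 0-based indices i,j: C(i, n-1-j)
-- (_C_ returns 0 when k > m, matching the convention)
R : (n : ℕ) → Mat n
R n i j = toℕ i C (n ∸ suc (toℕ j))

-- Index rows and columns from 0 and write n = m + 1, P = F_{e-1} + F_e x and
-- Q = F_e + F_{e+1} x.  Row i of R^e is the coefficient sequence of
-- P^{m-i} Q^i: for e = 0 this is x^i, and multiplying a row vector p of
-- degree ≤ m by R gives the coefficients of x^m p(1 + 1/x), a substitution
-- turning each linear factor c₀ + c₁ x into c₁ + (c₀ + c₁) x, which is exactly
-- one Fibonacci step on P and Q.  Both sides of the identity are then the same
-- coefficient of P^{m-i} Q^{i+1}: the left one from P · (row i+1), the right
-- one from Q · (row i).

module Submission where

open import Defs
open import Data.Nat using (ℕ; suc; _≤_; _∸_)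
open import Data.Fin using (Fin; inject₁)
open import Data.Integer using (ℤ; +_; _+_; _-_; _*_)
open import Relation.Binary.PropositionalEquality using (_≡_)

open import Data.Nat as ℕ using (zero; _<_; z≤n; s≤s)
import Data.Nat.Properties as ℕ
open import Data.Nat.Combinatorics using (_C_; k>n⇒nCk≡0; nCk+nC[k+1]≡[n+1]C[k+1])
open import Data.Nat.ListAction using (sum)
open import Data.Nat.Tactic.RingSolver using (solve-∀)
open import Data.Fin using (toℕ)
open import Data.Fin.Properties using (toℕ<n; toℕ-inject₁)
open import Data.List using (map; allFin; tabulate)
open import Data.List.Properties using (map-cong; map-tabulate)
import Data.Integer.Properties as ℤ
open import Algebra.Properties.AbelianGroup ℤ.+-0-abelianGroup using (//-rightDividesʳ)
open import Function using (_∘_)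
open import Relation.Binary.PropositionalEquality
  using (refl; sym; trans; cong; cong₂; subst; _≗_; module ≡-Reasoning)

Poly : Set
Poly = ℕ → ℕ

∑< : ℕ → (ℕ → ℕ) → ℕ
∑< zero    f = 0
∑< (suc n) f = f 0 ℕ.+ ∑< n (f ∘ suc)

infix 1 ∑<
syntax ∑< n (λ j → e) = ∑[ j < n ] e

∑-cong : ∀ n {f g : ℕ → ℕ} → f ≗ g → ∑< n f ≡ ∑< n g
∑-cong zero    f≗g = refl
∑-cong (suc n) f≗g = cong₂ ℕ._+_ (f≗g 0) (∑-cong n (f≗g ∘ suc))

∑-distrib-+ : ∀ n (f g : ℕ → ℕ) → (∑[ j < n ] f j ℕ.+ g j) ≡ ∑< n f ℕ.+ ∑< n g
∑-distrib-+ zero    f g = refl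
∑-distrib-+ (suc n) f g = begin
  f 0 ℕ.+ g 0 ℕ.+ (∑[ j < n ] f (suc j) ℕ.+ g (suc j))
    ≡⟨ cong (f 0 ℕ.+ g 0 ℕ.+_) (∑-distrib-+ n (f ∘ suc) (g ∘ suc)) ⟩
  f 0 ℕ.+ g 0 ℕ.+ (∑< n (f ∘ suc) ℕ.+ ∑< n (g ∘ suc))
    ≡⟨ interchange (f 0) (g 0) _ _ ⟩
  f 0 ℕ.+ ∑< n (f ∘ suc) ℕ.+ (g 0 ℕ.+ ∑< n (g ∘ suc)) ∎
  where
  open ≡-Reasoning
  interchange : ∀ a b c d → a ℕ.+ b ℕ.+ (c ℕ.+ d) ≡ a ℕ.+ c ℕ.+ (b ℕ.+ d)
  interchange = solve-∀

*-distribˡ-∑ : ∀ n c (f : ℕ → ℕ) → c ℕ.* ∑< n f ≡ (∑[ j < n ] c ℕ.* f j)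
*-distribˡ-∑ zero    c f = ℕ.*-zeroʳ c
*-distribˡ-∑ (suc n) c f =
  trans (ℕ.*-distribˡ-+ c (f 0) _) (cong (c ℕ.* f 0 ℕ.+_) (*-distribˡ-∑ n c (f ∘ suc)))

∑-init-last : ∀ n (f : ℕ → ℕ) → ∑< (suc n) f ≡ ∑< n f ℕ.+ f n
∑-init-last zero    f = ℕ.+-comm (f 0) 0
∑-init-last (suc n) f =
  trans (cong (f 0 ℕ.+_) (∑-init-last n (f ∘ suc))) (sym (ℕ.+-assoc (f 0) _ _))

∑-zero : ∀ n (f : ℕ → ℕ) → (∀ j → j < n → f j ≡ 0) → ∑< n f ≡ 0
∑-zero zero    f f≡0 = refl
∑-zero (suc n) f f≡0 =
  cong₂ ℕ._+_ (f≡0 0 (s≤s z≤n)) (∑-zero n (f ∘ suc) (λ j j<n → f≡0 (suc j) (s≤s j<n)))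

sum-map-allFin : ∀ n (f : ℕ → ℕ) → sum (map (f ∘ toℕ) (allFin n)) ≡ ∑< n f
sum-map-allFin n f =
  trans (cong sum (map-tabulate {n = n} (λ j → j) (f ∘ toℕ))) (sum-tabulate n f)
  where
  sum-tabulate : ∀ n (f : ℕ → ℕ) → sum (tabulate {n = n} (f ∘ toℕ)) ≡ ∑< n f
  sum-tabulate zero    f = refl
  sum-tabulate (suc n) f = cong (f 0 ℕ.+_) (sum-tabulate n (f ∘ suc))

shift : Poly → Poly
shift p zero    = 0
shift p (suc j) = p j

one : Poly
one zero    = 1
one (suc _) = 0

mulLinear : ℕ → ℕ → Poly → Poly
mulLinear c₀ c₁ p j = c₀ ℕ.* p j ℕ.+ c₁ ℕ.* shift p j

powLinear : ℕ → ℕ → ℕ → Poly → Poly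
powLinear c₀ c₁ zero    p = p
powLinear c₀ c₁ (suc n) p = mulLinear c₀ c₁ (powLinear c₀ c₁ n p)

mulLinear-cong : ∀ c₀ c₁ {p q} → p ≗ q → mulLinear c₀ c₁ p ≗ mulLinear c₀ c₁ q
mulLinear-cong c₀ c₁ p≗q zero    = cong (λ x → c₀ ℕ.* x ℕ.+ c₁ ℕ.* 0) (p≗q 0)
mulLinear-cong c₀ c₁ p≗q (suc j) =
  cong₂ (λ x y → c₀ ℕ.* x ℕ.+ c₁ ℕ.* y) (p≗q (suc j)) (p≗q j)

powLinear-cong : ∀ c₀ c₁ n {p q} → p ≗ q → powLinear c₀ c₁ n p ≗ powLinear c₀ c₁ n q
powLinear-cong c₀ c₁ zero    p≗q = p≗q
powLinear-cong c₀ c₁ (suc n) p≗q = mulLinear-cong c₀ c₁ (powLinear-cong c₀ c₁ n p≗q)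

mulLinear-comm : ∀ a₀ a₁ b₀ b₁ p →
  mulLinear a₀ a₁ (mulLinear b₀ b₁ p) ≗ mulLinear b₀ b₁ (mulLinear a₀ a₁ p)
mulLinear-comm a₀ a₁ b₀ b₁ p zero    = comm₀ a₀ a₁ b₀ b₁ (p 0)
  where
  comm₀ : ∀ a₀ a₁ b₀ b₁ x →
    a₀ ℕ.* (b₀ ℕ.* x ℕ.+ b₁ ℕ.* 0) ℕ.+ a₁ ℕ.* 0 ≡ b₀ ℕ.* (a₀ ℕ.* x ℕ.+ a₁ ℕ.* 0) ℕ.+ b₁ ℕ.* 0
  comm₀ = solve-∀
mulLinear-comm a₀ a₁ b₀ b₁ p (suc j) = comm₁ a₀ a₁ b₀ b₁ (p (suc j)) (p j) (shift p j)
  where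
  comm₁ : ∀ a₀ a₁ b₀ b₁ x y z →
    a₀ ℕ.* (b₀ ℕ.* x ℕ.+ b₁ ℕ.* y) ℕ.+ a₁ ℕ.* (b₀ ℕ.* y ℕ.+ b₁ ℕ.* z)
      ≡ b₀ ℕ.* (a₀ ℕ.* x ℕ.+ a₁ ℕ.* y) ℕ.+ b₁ ℕ.* (a₀ ℕ.* y ℕ.+ a₁ ℕ.* z)
  comm₁ = solve-∀

powLinear-comm : ∀ a₀ a₁ n b₀ b₁ p →
  powLinear a₀ a₁ n (mulLinear b₀ b₁ p) ≗ mulLinear b₀ b₁ (powLinear a₀ a₁ n p)
powLinear-comm a₀ a₁ zero    b₀ b₁ p = λ _ → refl
powLinear-comm a₀ a₁ (suc n) b₀ b₁ p j = trans
  (mulLinear-cong a₀ a₁ (powLinear-comm a₀ a₁ n b₀ b₁ p) j)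
  (mulLinear-comm a₀ a₁ b₀ b₁ _ j)

powLinear-1-0 : ∀ n p → powLinear 1 0 n p ≗ p
powLinear-1-0 zero    p j = refl
powLinear-1-0 (suc n) p j =
  trans (ℕ.+-identityʳ _) (trans (ℕ.+-identityʳ _) (powLinear-1-0 n p j))

DegreeAtMost : ℕ → Poly → Set
DegreeAtMost d p = ∀ j → d < j → p j ≡ 0

one-degree : DegreeAtMost 0 one
one-degree (suc j) _ = refl

mulLinear-degree : ∀ c₀ c₁ {d p} → DegreeAtMost d p → DegreeAtMost (suc d) (mulLinear c₀ c₁ p)
mulLinear-degree c₀ c₁ {p = p} deg (suc j) (s≤s d<j) = begin
  c₀ ℕ.* p (suc j) ℕ.+ c₁ ℕ.* p j ≡⟨ cong₂ (λ x y → c₀ ℕ.* x ℕ.+ c₁ ℕ.* y)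
                                        (deg (suc j) (ℕ.m<n⇒m<1+n d<j)) (deg j d<j) ⟩
  c₀ ℕ.* 0 ℕ.+ c₁ ℕ.* 0           ≡⟨ cong₂ ℕ._+_ (ℕ.*-zeroʳ c₀) (ℕ.*-zeroʳ c₁) ⟩
  0                               ∎
  where open ≡-Reasoning

powLinear-degree : ∀ c₀ c₁ n {d p} →
  DegreeAtMost d p → DegreeAtMost (n ℕ.+ d) (powLinear c₀ c₁ n p)
powLinear-degree c₀ c₁ zero    deg = deg
powLinear-degree c₀ c₁ (suc n) deg = mulLinear-degree c₀ c₁ (powLinear-degree c₀ c₁ n deg)

powLinear-one-degree : ∀ c₀ c₁ n → DegreeAtMost n (powLinear c₀ c₁ n one)
powLinear-one-degree c₀ c₁ n =
  subst (λ d → DegreeAtMost d (powLinear c₀ c₁ n one)) (ℕ.+-identityʳ n)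
        (powLinear-degree c₀ c₁ n one-degree)

-- Rℕ m j k is the entry (j, k) of R (suc m), extended to all j k : ℕ by 0 for
-- k > m, where the formula j C (m ∸ k) would give j C 0 = 1 instead.
Rℕ : ℕ → ℕ → ℕ → ℕ
Rℕ m       j zero    = j C m
Rℕ zero    j (suc k) = 0
Rℕ (suc m) j (suc k) = Rℕ m j k

Rℕ-pascal : ∀ m j k → Rℕ m (suc j) k ≡ Rℕ m j k ℕ.+ Rℕ m j (suc k)
Rℕ-pascal zero    j zero    = refl
Rℕ-pascal (suc m) j zero    =
  trans (sym (nCk+nC[k+1]≡[n+1]C[k+1] j m)) (ℕ.+-comm (j C m) (j C suc m))
Rℕ-pascal zero    j (suc k) = refl
Rℕ-pascal (suc m) j (suc k) = Rℕ-pascal m j k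

Rℕ-binomial : ∀ m j k → k ≤ m → Rℕ m j k ≡ j C (m ∸ k)
Rℕ-binomial m       j zero    _         = refl
Rℕ-binomial (suc m) j (suc k) (s≤s k≤m) = Rℕ-binomial m j k k≤m

timesR : ℕ → Poly → Poly
timesR m p k = ∑[ j < suc m ] p j ℕ.* Rℕ m j k

timesR-one : timesR 0 one ≗ one
timesR-one zero    = refl
timesR-one (suc k) = refl

timesR-linear : ∀ n c₀ c₁ p k →
  timesR n (mulLinear c₀ c₁ p) k ≡ c₀ ℕ.* timesR n p k ℕ.+ c₁ ℕ.* timesR n (shift p) k
timesR-linear n c₀ c₁ p k = begin
  (∑[ j < suc n ] (c₀ ℕ.* p j ℕ.+ c₁ ℕ.* shift p j) ℕ.* Rℕ n j k)
    ≡⟨ ∑-cong (suc n) (λ j → distrib c₀ c₁ (p j) (shift p j) (Rℕ n j k)) ⟩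
  (∑[ j < suc n ] c₀ ℕ.* (p j ℕ.* Rℕ n j k) ℕ.+ c₁ ℕ.* (shift p j ℕ.* Rℕ n j k))
    ≡⟨ ∑-distrib-+ (suc n) (λ j → c₀ ℕ.* (p j ℕ.* Rℕ n j k))
                           (λ j → c₁ ℕ.* (shift p j ℕ.* Rℕ n j k)) ⟩
  (∑[ j < suc n ] c₀ ℕ.* (p j ℕ.* Rℕ n j k))
    ℕ.+ (∑[ j < suc n ] c₁ ℕ.* (shift p j ℕ.* Rℕ n j k))
    ≡⟨ sym (cong₂ ℕ._+_ (*-distribˡ-∑ (suc n) c₀ (λ j → p j ℕ.* Rℕ n j k))
                        (*-distribˡ-∑ (suc n) c₁ (λ j → shift p j ℕ.* Rℕ n j k))) ⟩
  c₀ ℕ.* timesR n p k ℕ.+ c₁ ℕ.* timesR n (shift p) k ∎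
  where
  open ≡-Reasoning
  distrib : ∀ c₀ c₁ x y r → (c₀ ℕ.* x ℕ.+ c₁ ℕ.* y) ℕ.* r ≡ c₀ ℕ.* (x ℕ.* r) ℕ.+ c₁ ℕ.* (y ℕ.* r)
  distrib = solve-∀

module _ {m : ℕ} {p : Poly} (deg : DegreeAtMost m p) where

  timesR-drop-top : ∀ k → (∑[ j < suc m ] p j ℕ.* Rℕ (suc m) j k) ≡ timesR (suc m) p k
  timesR-drop-top k = sym (begin
    timesR (suc m) p k                                ≡⟨ ∑-init-last (suc m) f ⟩
    ∑< (suc m) f ℕ.+ p (suc m) ℕ.* Rℕ (suc m) (suc m) k
      ≡⟨ cong (λ x → ∑< (suc m) f ℕ.+ x ℕ.* Rℕ (suc m) (suc m) k) (deg (suc m) ℕ.≤-refl) ⟩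
    ∑< (suc m) f ℕ.+ 0                                ≡⟨ ℕ.+-identityʳ _ ⟩
    ∑< (suc m) f                                      ∎)
    where
    open ≡-Reasoning
    f : ℕ → ℕ
    f j = p j ℕ.* Rℕ (suc m) j k

  timesR-suc : timesR (suc m) p ≗ shift (timesR m p)
  timesR-suc zero    = trans (sym (timesR-drop-top 0)) (∑-zero (suc m) _ λ j j<1+m →
    trans (cong (p j ℕ.*_) (k>n⇒nCk≡0 j<1+m)) (ℕ.*-zeroʳ (p j)))
  timesR-suc (suc k) = sym (timesR-drop-top (suc k))

  timesR-shift : ∀ k → timesR (suc m) (shift p) k ≡ timesR (suc m) p k ℕ.+ timesR m p k
  timesR-shift k = begin
    (∑[ j < suc m ] p j ℕ.* Rℕ (suc m) (suc j) k)
      ≡⟨ ∑-cong (suc m) (λ j → trans (cong (p j ℕ.*_) (Rℕ-pascal (suc m) j k))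
                                      (ℕ.*-distribˡ-+ (p j) (Rℕ (suc m) j k) (Rℕ m j k))) ⟩
    (∑[ j < suc m ] p j ℕ.* Rℕ (suc m) j k ℕ.+ p j ℕ.* Rℕ (suc m) j (suc k))
      ≡⟨ ∑-distrib-+ (suc m) (λ j → p j ℕ.* Rℕ (suc m) j k) (λ j → p j ℕ.* Rℕ m j k) ⟩
    (∑[ j < suc m ] p j ℕ.* Rℕ (suc m) j k) ℕ.+ timesR m p k
      ≡⟨ cong (ℕ._+ timesR m p k) (timesR-drop-top k) ⟩
    timesR (suc m) p k ℕ.+ timesR m p k ∎
    where open ≡-Reasoning

  timesR-mulLinear : ∀ c₀ c₁ →
    timesR (suc m) (mulLinear c₀ c₁ p) ≗ mulLinear c₁ (c₁ ℕ.+ c₀) (timesR m p)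
  timesR-mulLinear c₀ c₁ k = begin
    timesR (suc m) (mulLinear c₀ c₁ p) k
      ≡⟨ timesR-linear (suc m) c₀ c₁ p k ⟩
    c₀ ℕ.* timesR (suc m) p k ℕ.+ c₁ ℕ.* timesR (suc m) (shift p) k
      ≡⟨ cong (λ x → c₀ ℕ.* timesR (suc m) p k ℕ.+ c₁ ℕ.* x) (timesR-shift k) ⟩
    c₀ ℕ.* timesR (suc m) p k ℕ.+ c₁ ℕ.* (timesR (suc m) p k ℕ.+ timesR m p k)
      ≡⟨ cong (λ s → c₀ ℕ.* s ℕ.+ c₁ ℕ.* (s ℕ.+ timesR m p k)) (timesR-suc k) ⟩
    c₀ ℕ.* shift (timesR m p) k ℕ.+ c₁ ℕ.* (shift (timesR m p) k ℕ.+ timesR m p k)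
      ≡⟨ regroup c₀ c₁ _ _ ⟩
    mulLinear c₁ (c₁ ℕ.+ c₀) (timesR m p) k ∎
    where
    open ≡-Reasoning
    regroup : ∀ c₀ c₁ s t → c₀ ℕ.* s ℕ.+ c₁ ℕ.* (s ℕ.+ t) ≡ c₁ ℕ.* t ℕ.+ (c₁ ℕ.+ c₀) ℕ.* s
    regroup = solve-∀

timesR-powLinear : ∀ c₀ c₁ n {d p} → DegreeAtMost d p →
  timesR (n ℕ.+ d) (powLinear c₀ c₁ n p) ≗ powLinear c₁ (c₁ ℕ.+ c₀) n (timesR d p)
timesR-powLinear c₀ c₁ zero    deg k = refl
timesR-powLinear c₀ c₁ (suc n) deg k = trans
  (timesR-mulLinear (powLinear-degree c₀ c₁ n deg) c₀ c₁ k)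
  (mulLinear-cong c₁ (c₁ ℕ.+ c₀) (timesR-powLinear c₀ c₁ n deg) k)

timesR-powLinear-one : ∀ c₀ c₁ n →
  timesR n (powLinear c₀ c₁ n one) ≗ powLinear c₁ (c₁ ℕ.+ c₀) n one
timesR-powLinear-one c₀ c₁ n k = begin
  timesR n (powLinear c₀ c₁ n one) k
    ≡⟨ cong (λ d → timesR d (powLinear c₀ c₁ n one) k) (sym (ℕ.+-identityʳ n)) ⟩
  timesR (n ℕ.+ 0) (powLinear c₀ c₁ n one) k
    ≡⟨ timesR-powLinear c₀ c₁ n one-degree k ⟩
  powLinear c₁ (c₁ ℕ.+ c₀) n (timesR 0 one) k
    ≡⟨ powLinear-cong c₁ (c₁ ℕ.+ c₀) n timesR-one k ⟩
  powLinear c₁ (c₁ ℕ.+ c₀) n one k ∎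
  where open ≡-Reasoning

-- F_{e-1}, with F_{-1} = 1 so that F_{e+1} = F_e + F_{e-1} holds for all e.
fibPred : ℕ → ℕ
fibPred zero    = 1
fibPred (suc e) = fib e

fib+fibPred : ∀ e → fib e ℕ.+ fibPred e ≡ fib (suc e)
fib+fibPred zero    = refl
fib+fibPred (suc e) = refl

rowPoly : ℕ → ℕ → ℕ → Poly
rowPoly e a b = powLinear (fibPred e) (fib e) a (powLinear (fib e) (fib (suc e)) b one)

timesR-rowPoly : ∀ e a b → timesR (a ℕ.+ b) (rowPoly e a b) ≗ rowPoly (suc e) a b
timesR-rowPoly e a b k = begin
  timesR (a ℕ.+ b) (powLinear (fibPred e) (fib e) a Q) k
    ≡⟨ timesR-powLinear (fibPred e) (fib e) a (powLinear-one-degree (fib e) (fib (suc e)) b) k ⟩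
  powLinear (fib e) (fib e ℕ.+ fibPred e) a (timesR b Q) k
    ≡⟨ powLinear-cong (fib e) (fib e ℕ.+ fibPred e) a
         (timesR-powLinear-one (fib e) (fib (suc e)) b) k ⟩
  powLinear (fib e) (fib e ℕ.+ fibPred e) a Q′ k
    ≡⟨ cong (λ c → powLinear (fib e) c a Q′ k) (fib+fibPred e) ⟩
  powLinear (fib e) (fib (suc e)) a Q′ k ∎
  where
  open ≡-Reasoning
  Q Q′ : Poly
  Q  = powLinear (fib e) (fib (suc e)) b one
  Q′ = powLinear (fib (suc e)) (fib (suc (suc e))) b one

rowPoly-adjacent : ∀ e a b →
  mulLinear (fibPred e) (fib e) (rowPoly e a (suc b))
    ≗ mulLinear (fib e) (fib (suc e)) (rowPoly e (suc a) b)
rowPoly-adjacent e a b =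
  powLinear-comm (fibPred e) (fib e) (suc a) (fib e) (fib (suc e))
                 (powLinear (fib e) (fib (suc e)) b one)

I-powLinear : ∀ {n} (i k : Fin n) → I i k ≡ powLinear 0 1 (toℕ i) one (toℕ k)
I-powLinear {suc n} Fin.zero    Fin.zero    = refl
I-powLinear {suc n} Fin.zero    (Fin.suc k) = refl
I-powLinear {suc n} (Fin.suc i) Fin.zero    = refl
I-powLinear {suc n} (Fin.suc i) (Fin.suc k) = trans (I-powLinear i k) (sym (ℕ.+-identityʳ _))

⊗-R-row : ∀ m (A : Mat (suc m)) i p → (∀ j → A i j ≡ p (toℕ j)) →
  ∀ k → (A ⊗ R (suc m)) i k ≡ timesR m p (toℕ k)
⊗-R-row m A i p row k = trans
  (cong sum (map-cong entry (allFin (suc m))))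
  (sum-map-allFin (suc m) (λ j → p j ℕ.* Rℕ m j (toℕ k)))
  where
  entry : ∀ j → A i j ℕ.* R (suc m) j k ≡ p (toℕ j) ℕ.* Rℕ m (toℕ j) (toℕ k)
  entry j = cong₂ ℕ._*_ (row j) (sym (Rℕ-binomial m (toℕ j) (toℕ k) (ℕ.s≤s⁻¹ (toℕ<n k))))

R^e-row : ∀ m e (i k : Fin (suc m)) →
  (R (suc m) ^ᴹ e) i k ≡ rowPoly e (m ∸ toℕ i) (toℕ i) (toℕ k)
R^e-row m zero    i k =
  trans (I-powLinear i k) (sym (powLinear-1-0 (m ∸ toℕ i) _ (toℕ k)))
R^e-row m (suc e) i k = begin
  ((R (suc m) ^ᴹ e) ⊗ R (suc m)) i k
    ≡⟨ ⊗-R-row m (R (suc m) ^ᴹ e) i (rowPoly e a b) (R^e-row m e i) k ⟩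
  timesR m (rowPoly e a b) (toℕ k)
    ≡⟨ cong (λ d → timesR d (rowPoly e a b) (toℕ k)) (sym (ℕ.m∸n+n≡m (ℕ.s≤s⁻¹ (toℕ<n i)))) ⟩
  timesR (a ℕ.+ b) (rowPoly e a b) (toℕ k)
    ≡⟨ timesR-rowPoly e a b (toℕ k) ⟩
  rowPoly (suc e) a b (toℕ k) ∎
  where
  open ≡-Reasoning
  a b : ℕ
  a = m ∸ toℕ i
  b = toℕ i

R^e-adjacent : ∀ m e (i j : Fin m) → let a = R (suc m) ^ᴹ e in
  fibPred e ℕ.* a (Fin.suc i) (Fin.suc j) ℕ.+ fib e ℕ.* a (Fin.suc i) (inject₁ j)
    ≡ fib e ℕ.* a (inject₁ i) (Fin.suc j) ℕ.+ fib (suc e) ℕ.* a (inject₁ i) (inject₁ j)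
R^e-adjacent m e i j
  rewrite R^e-row m e (Fin.suc i) (Fin.suc j) | R^e-row m e (Fin.suc i) (inject₁ j)
        | R^e-row m e (inject₁ i) (Fin.suc j) | R^e-row m e (inject₁ i) (inject₁ j)
        | toℕ-inject₁ i | toℕ-inject₁ j | ℕ.+-∸-assoc 1 (toℕ<n i)
  = rowPoly-adjacent e (m ∸ suc (toℕ i)) (toℕ i) (suc (toℕ j))

pos-linear : ∀ a x b y → + (a ℕ.* x ℕ.+ b ℕ.* y) ≡ + a * + x + + b * + y
pos-linear a x b y = trans (ℤ.pos-+ (a ℕ.* x) (b ℕ.* y)) (cong₂ _+_ (ℤ.pos-* a x) (ℤ.pos-* b y))

i+j≡k⇒i≡k-j : ∀ {i j k : ℤ} → i + j ≡ k → i ≡ k - j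
i+j≡k⇒i≡k-j {i} {j} refl = sym (//-rightDividesʳ j i)

ℕ-identity⇒ℤ : ∀ a x b y c z d w → a ℕ.* x ℕ.+ b ℕ.* y ≡ c ℕ.* z ℕ.+ d ℕ.* w →
  + a * + x ≡ + c * + z + + d * + w - + b * + y
ℕ-identity⇒ℤ a x b y c z d w eq =
  i+j≡k⇒i≡k-j (trans (sym (pos-linear a x b y)) (trans (cong +_ eq) (pos-linear c z d w)))

theorem4 : (m : ℕ) → 2 ≤ suc m → (e : ℕ) → 1 ≤ e → (i' j' : Fin m) →
    let a = R (suc m) ^ᴹ e
        i = Fin.suc i'
        i₁ = inject₁ i'
        j = Fin.suc j'
        j₁ = inject₁ j'
    in + fib (e ∸ 1) * + a i j
       ≡ + fib e * + a i₁ j + + fib (suc e) * + a i₁ j₁ - + fib e * + a i j₁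
theorem4 m _ e@(suc d) _ i j = ℕ-identity⇒ℤ
  (fib d) (A (Fin.suc i) (Fin.suc j)) (fib e) (A (Fin.suc i) (inject₁ j))
  (fib e) (A (inject₁ i) (Fin.suc j)) (fib (suc e)) (A (inject₁ i) (inject₁ j))
  (R^e-adjacent m e i j)
  where
  A : Mat (suc m)
  A = R (suc m) ^ᴹ e
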